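{- Let $G$ be a triangle-free graph with $\mathrm{diam}(G)=2$. If the complement $\overline{G}$ is connected, then $rc(\overline{G})\leq 5$.
   Context: All graphs are finite, undirected and simple. For an edge-coloring $c:E(H)\to\{1,\dots,k\}$ (adjacent edges may receive the same color), a path is rainbow if no two of its edges have the same color; $H$ is rainbow connected under $c$ if every two vertices are joined by a rainbow path. The rainbow connection number $rc(H)$ of a nontrivial connected graph $H$ is the minimum $k$ for which such a coloring with $k$ colors exists. $\mathrm{diam}$ denotes diameter and $\overline{G}$ the complement of $G$. -}

module Defs where

open import Data.Nat using (ℕ)
open import Data.Fin using (Fin)
open import Data.List using (List; []; _∷_)
open import Data.List.Relation.Unary.Unique.Propositional using (Unique)
open import Data.List.Relation.Unary.AllPairs using (AllPairs)
open import Data.Product using (Σ; ∃; ∃-syntax; _×_; _,_)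
open import Data.Sum using (_⊎_)
open import Relation.Nullary using (¬_; Dec)
open import Relation.Binary.PropositionalEquality using (_≡_; _≢_)

record Graph (n : ℕ) : Set₁ where
  field
    Adj    : Fin n → Fin n → Set
    sym    : ∀ {u v} → Adj u v → Adj v u
    irrefl : ∀ {u} → ¬ Adj u u
    dec    : ∀ u v → Dec (Adj u v)
open Graph public

complement : ∀ {n} → Graph n → Graph n
complement {n} G = record
  { Adj    = λ u v → (u ≢ v) × ¬ Adj G u v
  ; sym    = λ { (u≢v , ¬a) → (λ e → u≢v (sym≡ e)) , (λ a → ¬a (sym G a)) }
  ; irrefl = λ { (u≢u , _) → u≢u refl≡ }
  ; dec    = decC
  }
  where
  open import Relation.Binary.PropositionalEquality using () renaming (sym to sym≡; refl to refl≡)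
  open import Data.Fin using (_≟_)
  open import Relation.Nullary using (_×-dec_; ¬?)
  decC : ∀ u v → Dec ((u ≢ v) × ¬ Adj G u v)
  decC u v = ¬? (u ≟ v) ×-dec ¬? (dec G u v)

data IsWalk {n} (G : Graph n) : List (Fin n) → Set where
  []  : IsWalk G []
  [_] : ∀ v → IsWalk G (v ∷ [])
  _∷_ : ∀ {u v vs} → Adj G u v → IsWalk G (v ∷ vs) → IsWalk G (u ∷ v ∷ vs)

data Head {n} (u : Fin n) : List (Fin n) → Set where
  here : ∀ {vs} → Head u (u ∷ vs)

data Last {n} (v : Fin n) : List (Fin n) → Set where
  last-one  : Last v (v ∷ [])
  last-cons : ∀ {w vs} → Last v vs → Last v (w ∷ vs)

IsPath : ∀ {n} → Graph n → Fin n → Fin n → List (Fin n) → Set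
IsPath G u v p = IsWalk G p × Unique p × Head u p × Last v p

edgeColours : ∀ {n k} → (Fin n → Fin n → Fin k) → List (Fin n) → List (Fin k)
edgeColours c []           = []
edgeColours c (u ∷ [])     = []
edgeColours c (u ∷ v ∷ vs) = c u v ∷ edgeColours c (v ∷ vs)

-- Edge colouring with k colours: a symmetric colour assignment to vertex
-- pairs (values on non-edges are irrelevant).
IsEdgeColouring : ∀ {n} (k : ℕ) → (Fin n → Fin n → Fin k) → Set
IsEdgeColouring k c = ∀ u v → c u v ≡ c v u

Rainbow : ∀ {n k} → (Fin n → Fin n → Fin k) → List (Fin n) → Set
Rainbow c p = Unique (edgeColours c p)

RainbowConnectedBy : ∀ {n k} → Graph n → (Fin n → Fin n → Fin k) → Set
RainbowConnectedBy G c = ∀ u v → ∃[ p ] (IsPath G u v p × Rainbow c p)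

rc≤ : ∀ {n} → Graph n → ℕ → Set
rc≤ {n} H k = Σ (Fin n → Fin n → Fin k) λ c → IsEdgeColouring k c × RainbowConnectedBy H c

Connected : ∀ {n} → Graph n → Set
Connected {n} G = ∀ (u v : Fin n) → ∃[ p ] IsPath G u v p

TriangleFree : ∀ {n} → Graph n → Set
TriangleFree G = ∀ u v w → Adj G u v → Adj G v w → Adj G u w → Data.Empty.⊥
  where import Data.Empty

Dist≤2 : ∀ {n} → Graph n → Fin n → Fin n → Set
Dist≤2 G u v = (u ≡ v) ⊎ Adj G u v ⊎ (∃[ w ] (Adj G u w × Adj G w v))

Dist≡2 : ∀ {n} → Graph n → Fin n → Fin n → Set
Dist≡2 G u v = (u ≢ v) × ¬ Adj G u v × (∃[ w ] (Adj G u w × Adj G w v))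

Diam≡2 : ∀ {n} → Graph n → Set
Diam≡2 {n} G = (∀ u v → Dist≤2 G u v) × (∃[ u ] ∃[ v ] Dist≡2 G u v)

-- Fix an edge uv of G and sort the vertices into u, v, N(u) - v, N(v) - u and the
-- remaining far vertices.  As G is triangle-free, N(u) and N(v) are cliques of the
-- complement H, u is H-adjacent to N(v) and to every far vertex, and v to N(u) and to
-- every far vertex.  Colour each H-edge by the classes of its ends.  If some far vertex r
-- exists, any two vertices are joined by a walk of length at most 4 through u, v and r;
-- two far vertices adjacent in G instead use a common G-neighbour of one of them and u,
-- which exists as diam G = 2.  Otherwise connectivity of H yields an H-edge between N(u)
-- and N(v), and the walks pass through it.  Every rainbow walk contains a rainbow path,
-- so it suffices that the class sequences of these walks are rainbow, which is decided
-- by evaluation.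

module Submission where

open import Defs
open import Data.Bool using (Bool; true; false; T)
open import Data.Bool.Properties using (T?)
open import Data.Empty using (⊥-elim)
open import Data.Fin using (Fin; zero; suc; _≟_; #_)
open import Data.Fin.Properties using (all?; any?)
open import Data.List using (List; []; _∷_)
open import Data.List.Membership.Propositional using (_∈_; _∉_)
import Data.List.Membership.DecPropositional as DecMembership
open import Data.List.Relation.Binary.Pointwise using (Pointwise; []; _∷_)
open import Data.List.Relation.Binary.Subset.Propositional using (_⊆_)
open import Data.List.Relation.Binary.Subset.Propositional.Properties using (∷⁺ʳ)
open import Data.List.Relation.Unary.All using ([])
open import Data.List.Relation.Unary.All.Properties using (¬Any⇒All¬; All¬⇒¬Any)
open import Data.List.Relation.Unary.AllPairs using ([]; _∷_)
open import Data.List.Relation.Unary.Any using (here; there)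
open import Data.List.Relation.Unary.Linked using (Linked; [-]; _∷_)
open import Data.List.Relation.Unary.Unique.Propositional using (Unique)
open import Data.List.Relation.Unary.Unique.DecPropositional (_≟_ {5}) using (unique?)
open import Data.Nat using (ℕ)
open import Data.Product using (∃; ∃-syntax; _×_; _,_; proj₁; proj₂)
open import Data.Sum using (inj₁; inj₂)
open import Data.Unit using (tt)
open import Function using (id; _∘_; case_of_)
open import Relation.Binary.Construct.Closure.Reflexive using (ReflClosure; refl; [_])
open import Relation.Binary.PropositionalEquality
  using (_≡_; _≢_; refl; trans; cong₂; subst) renaming (sym to ≡sym)
open import Relation.Nullary using (¬_; yes; no)
open import Relation.Nullary.Decidable using (True; toWitness)
open import Relation.Unary using (Decidable)

Dist≤1 : ∀ {n} → Graph n → Fin n → Fin n → Set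
Dist≤1 H = ReflClosure (Adj H)

end : ∀ {n} → Fin n → List (Fin n) → Fin n
end x []       = x
end _ (y ∷ ys) = end y ys

RainbowJoined : ∀ {n k} → Graph n → (Fin n → Fin n → Fin k) → Fin n → Fin n → Set
RainbowJoined H c x y = ∃[ p ] (IsPath H x y p × Rainbow c p)

module _ {n k} {H : Graph n} {c : Fin n → Fin n → Fin k} where

  open DecMembership (_≟_ {n}) using (_∈?_)

  RainbowJoinedWithin : List (Fin k) → Fin n → Fin n → Set
  RainbowJoinedWithin cs x y = ∃[ p ] (IsPath H x y p × Rainbow c p × edgeColours c p ⊆ cs)

  weaken : ∀ {cs ds x y} → cs ⊆ ds → RainbowJoinedWithin cs x y → RainbowJoinedWithin ds x y
  weaken cs⊆ds (p , path , rb , sub) = p , path , rb , cs⊆ds ∘ sub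

  suffix-from : ∀ {x y z qs} → x ∈ qs → IsPath H z y qs → Rainbow c qs →
                RainbowJoinedWithin (edgeColours c qs) x y
  suffix-from (here refl) (walk , distinct , here , last) rb =
    _ , (walk , distinct , here , last) , rb , id
  suffix-from (there ()) ([ _ ] , _)
  suffix-from (there x∈qs) (_ ∷ walk , _ ∷ distinct , here , last-cons last) (_ ∷ rb)
    = weaken there (suffix-from x∈qs (walk , distinct , here , last) rb)

  prepend : ∀ {x z y cs} → Dist≤1 H x z → c x z ∉ cs → RainbowJoinedWithin cs z y →
            RainbowJoinedWithin (c x z ∷ cs) x y
  prepend refl _ joined = weaken there joined
  prepend {x} [ adj ] fresh (qs , path , rb , sub) with x ∈? qs
  ... | yes x∈qs = weaken (there ∘ sub) (suffix-from x∈qs path rb)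
  prepend {x} [ adj ] fresh (qs , (walk , distinct , here , last) , rb , sub) | no x∉qs =
    x ∷ qs , (adj ∷ walk , ¬Any⇒All¬ qs x∉qs ∷ distinct , here , last-cons last) ,
    ¬Any⇒All¬ _ (fresh ∘ sub) ∷ rb , ∷⁺ʳ _ sub

  -- Cutting out the closed sub-walk at a repeated vertex only discards edges.
  shortcut : ∀ {x xs} → Linked (Dist≤1 H) (x ∷ xs) → Rainbow c (x ∷ xs) →
             RainbowJoinedWithin (edgeColours c (x ∷ xs)) x (end x xs)
  shortcut {x} [-] _ = x ∷ [] , ([ x ] , [] ∷ [] , here , last-one) , [] , λ ()
  shortcut (step ∷ steps) (fresh ∷ rb) = prepend step (All¬⇒¬Any fresh) (shortcut steps rb)

  rainbow-walk-joins : ∀ {x xs} → Linked (Dist≤1 H) (x ∷ xs) → Rainbow c (x ∷ xs) →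
                       RainbowJoined H c x (end x xs)
  rainbow-walk-joins steps rb = let p , path , rbp , _ = shortcut steps rb in p , path , rbp

exit-edge : ∀ {n} {H : Graph n} {P : Fin n → Set} → Decidable P →
            ∀ {s t ps} → IsWalk H ps → Head s ps → Last t ps → P s → ¬ P t →
            ∃[ x ] ∃[ y ] (Adj H x y × P x × ¬ P y)
exit-edge P? [ _ ] here last-one Ps ¬Pt = ⊥-elim (¬Pt Ps)
exit-edge P? (_∷_ {x} {y} adj walk) here (last-cons last) Ps ¬Pt with P? y
... | yes Py = exit-edge P? walk here last Py ¬Pt
... | no ¬Py = x , y , adj , Ps , ¬Py

¬Adj⇒Dist≤1ᶜ : ∀ {n} (G : Graph n) {x y} → ¬ Adj G x y → Dist≤1 (complement G) x y
¬Adj⇒Dist≤1ᶜ G {x} {y} ¬xy with x ≟ y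
... | yes refl = refl
... | no x≢y = [ x≢y , ¬xy ]

edgeColours-∘ : ∀ {n m k} {f : Fin n → Fin m} {t : Fin m → Fin m → Fin k} {xs js} →
                Pointwise (λ x j → f x ≡ j) xs js →
                edgeColours (λ x y → t (f x) (f y)) xs ≡ edgeColours t js
edgeColours-∘ [] = refl
edgeColours-∘ (_ ∷ []) = refl
edgeColours-∘ {t = t} (fx ∷ fy ∷ rest) = cong₂ _∷_ (cong₂ t fx fy) (edgeColours-∘ (fy ∷ rest))

-- Coded in Fin 5 so that class sequences can be coloured by edgeColours and
-- tested for rainbowness by unique?.
Class : Set
Class = Fin 5

pattern U   = zero
pattern V   = suc zero
pattern Nu  = suc (suc zero)
pattern Nv  = suc (suc (suc zero))
pattern Far = suc (suc (suc (suc zero)))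

-- Only the class pairs met by the routes below matter; the values make each route rainbow.
colourTable : Class → Class → Fin 5
colourTable U   Far = # 0
colourTable Far U   = # 0
colourTable V   Far = # 1
colourTable Far V   = # 1
colourTable U   Nv  = # 2
colourTable Nv  U   = # 2
colourTable V   Nu  = # 3
colourTable Nu  V   = # 3
colourTable Nu  Nu  = # 4
colourTable Nv  Nv  = # 1
colourTable Nu  Far = # 4
colourTable Far Nu  = # 4
colourTable _   _   = # 0

colourTable-sym : ∀ k l → colourTable k l ≡ colourTable l k
colourTable-sym = toWitness {a? = all? λ k → all? λ l → colourTable k l ≟ colourTable l k} _

module EdgePartition {n} (G : Graph n) (triangle-free : TriangleFree G) (u v : Fin n) (uv : Adj G u v) where

  H : Graph n
  H = complement G

  data Classified (p : Fin n) : Class → Set where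
    at-u  : p ≡ u → Classified p U
    at-v  : p ≢ u → p ≡ v → Classified p V
    in-Nu : p ≢ v → Adj G u p → Classified p Nu
    in-Nv : p ≢ u → ¬ Adj G u p → Adj G v p → Classified p Nv
    far   : ¬ Adj G u p → ¬ Adj G v p → Classified p Far

  classify : ∀ p → ∃ (Classified p)
  classify p with p ≟ u | p ≟ v | dec G u p | dec G v p
  ... | yes p≡u | _       | _      | _      = U   , at-u p≡u
  ... | no p≢u  | yes p≡v | _      | _      = V   , at-v p≢u p≡v
  ... | no _    | no p≢v  | yes up | _      = Nu  , in-Nu p≢v up
  ... | no p≢u  | no _    | no ¬up | yes vp = Nv  , in-Nv p≢u ¬up vp
  ... | no _    | no _    | no ¬up | no ¬vp = Far , far ¬up ¬vp

  -- Opaque, so that a vertex x can be inferred from an equation cls x ≡ k.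
  opaque
    cls : Fin n → Class
    cls p = proj₁ (classify p)

    view : ∀ {p k} → cls p ≡ k → Classified p k
    view {p} refl = proj₂ (classify p)

    cls-u : cls u ≡ U
    cls-u with classify u
    ... | U   , _            = refl
    ... | V   , at-v u≢u _   = ⊥-elim (u≢u refl)
    ... | Nu  , in-Nu _ uu   = ⊥-elim (irrefl G uu)
    ... | Nv  , in-Nv u≢u _ _ = ⊥-elim (u≢u refl)
    ... | Far , far _ ¬vu    = ⊥-elim (¬vu (sym G uv))

    cls-v : cls v ≡ V
    cls-v with classify v
    ... | U   , at-u refl    = ⊥-elim (irrefl G uv)
    ... | V   , _            = refl
    ... | Nu  , in-Nu v≢v _  = ⊥-elim (v≢v refl)
    ... | Nv  , in-Nv _ _ vv = ⊥-elim (irrefl G vv)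
    ... | Far , far ¬uv _    = ⊥-elim (¬uv uv)

    cls-Nu : ∀ {p} → Adj G u p → p ≢ v → cls p ≡ Nu
    cls-Nu {p} up p≢v with classify p
    ... | U   , at-u refl      = ⊥-elim (irrefl G up)
    ... | V   , at-v _ p≡v     = ⊥-elim (p≢v p≡v)
    ... | Nu  , _              = refl
    ... | Nv  , in-Nv _ ¬up _  = ⊥-elim (¬up up)
    ... | Far , far ¬up _      = ⊥-elim (¬up up)

  U≁U : ∀ {x y} → cls x ≡ U → cls y ≡ U → ¬ Adj G x y
  U≁U ex ey with view ex | view ey
  ... | at-u refl | at-u refl = irrefl G

  V≁V : ∀ {x y} → cls x ≡ V → cls y ≡ V → ¬ Adj G x y
  V≁V ex ey with view ex | view ey
  ... | at-v _ refl | at-v _ refl = irrefl G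

  U≁Far : ∀ {x y} → cls x ≡ U → cls y ≡ Far → ¬ Adj G x y
  U≁Far ex ey with view ex | view ey
  ... | at-u refl | far ¬uy _ = ¬uy

  V≁Far : ∀ {x y} → cls x ≡ V → cls y ≡ Far → ¬ Adj G x y
  V≁Far ex ey with view ex | view ey
  ... | at-v _ refl | far _ ¬vy = ¬vy

  U≁Nv : ∀ {x y} → cls x ≡ U → cls y ≡ Nv → ¬ Adj G x y
  U≁Nv ex ey uy with view ex | view ey
  ... | at-u refl | in-Nv _ _ vy = triangle-free u _ v uy (sym G vy) uv

  V≁Nu : ∀ {x y} → cls x ≡ V → cls y ≡ Nu → ¬ Adj G x y
  V≁Nu ex ey vy with view ex | view ey
  ... | at-v _ refl | in-Nu _ uy = triangle-free v _ u vy (sym G uy) (sym G uv)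

  Nu≁Nu : ∀ {x y} → cls x ≡ Nu → cls y ≡ Nu → ¬ Adj G x y
  Nu≁Nu ex ey xy with view ex | view ey
  ... | in-Nu _ ux | in-Nu _ uy = triangle-free u _ _ ux xy uy

  Nv≁Nv : ∀ {x y} → cls x ≡ Nv → cls y ≡ Nv → ¬ Adj G x y
  Nv≁Nv ex ey xy with view ex | view ey
  ... | in-Nv _ _ vx | in-Nv _ _ vy = triangle-free v _ _ vx xy vy

  Step : Class → Class → Fin n → Fin n → Set
  Step k l x y = cls x ≡ k → cls y ≡ l → Dist≤1 H x y

  by : ∀ {k l x y} → (cls x ≡ k → cls y ≡ l → ¬ Adj G x y) → Step k l x y
  by ≁ ex ey = ¬Adj⇒Dist≤1ᶜ G (≁ ex ey)

  by˘ : ∀ {k l x y} → (cls y ≡ l → cls x ≡ k → ¬ Adj G y x) → Step k l x y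
  by˘ ≁ ex ey = ¬Adj⇒Dist≤1ᶜ G (≁ ey ex ∘ sym G)

  given : ∀ {k l x y} → Dist≤1 H x y → Step k l x y
  given step _ _ = step

  infixr 5 _⟨_⟩_
  infix  6 _∎

  data Route : List (Fin n) → List Class → Set where
    _∎    : ∀ {x k} → cls x ≡ k → Route (x ∷ []) (k ∷ [])
    _⟨_⟩_ : ∀ {x y xs k l ks} → cls x ≡ k → Step k l x y → Route (y ∷ xs) (l ∷ ks) →
            Route (x ∷ y ∷ xs) (k ∷ l ∷ ks)

  head-class : ∀ {x xs k ks} → Route (x ∷ xs) (k ∷ ks) → cls x ≡ k
  head-class (ex ∎)       = ex
  head-class (ex ⟨ _ ⟩ _) = ex

  route-steps : ∀ {xs ks} → Route xs ks → Linked (Dist≤1 H) xs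
  route-steps (_ ∎)           = [-]
  route-steps (ex ⟨ s ⟩ rest) = s ex (head-class rest) ∷ route-steps rest

  route-classes : ∀ {xs ks} → Route xs ks → Pointwise (λ x k → cls x ≡ k) xs ks
  route-classes (ex ∎)          = ex ∷ []
  route-classes (ex ⟨ _ ⟩ rest) = ex ∷ route-classes rest

  colouring : Fin n → Fin n → Fin 5
  colouring x y = colourTable (cls x) (cls y)

  route : ∀ {x xs ks} → Route (x ∷ xs) ks → {_ : True (unique? (edgeColours colourTable ks))} →
          RainbowJoined H colouring x (end x xs)
  route r {rainbow} = rainbow-walk-joins (route-steps r)
    (subst Unique (≡sym (edgeColours-∘ (route-classes r))) (toWitness rainbow))

  joined-far-far : (∀ p q → Dist≤2 G p q) → ∀ {p q} → cls p ≡ Far → cls q ≡ Far →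
                   RainbowJoined H colouring p q
  joined-far-far diam {p} {q} ep eq with dec G p q | view ep
  ... | no ¬pq | _ = route (ep ⟨ given (¬Adj⇒Dist≤1ᶜ G ¬pq) ⟩ eq ∎)
  ... | yes pq | far ¬up ¬vp with diam p u
  ...   | inj₁ refl = case trans (≡sym cls-u) ep of λ ()
  ...   | inj₂ (inj₁ pu) = ⊥-elim (¬up (sym G pu))
  ...   | inj₂ (inj₂ (w , pw , wu)) =
    route (ep ⟨ by˘ V≁Far ⟩ cls-v ⟨ by V≁Nu ⟩ ew ⟨ given (¬Adj⇒Dist≤1ᶜ G w≁q) ⟩ eq ∎)
    where
    ew : cls w ≡ Nu
    ew = cls-Nu (sym G wu) λ { refl → ¬vp (sym G pw) }
    w≁q : ¬ Adj G w q
    w≁q wq = triangle-free p q w pq (sym G wq) pw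

  joined-via-far : ∀ {r} → cls r ≡ Far → (∀ p q → Dist≤2 G p q) →
                   ∀ p q → RainbowJoined H colouring p q
  joined-via-far er diam p q with cls p in ep | cls q in eq
  ... | U   | U   = route (ep ⟨ by U≁U ⟩ eq ∎)
  ... | U   | V   = route (ep ⟨ by U≁Far ⟩ er ⟨ by˘ V≁Far ⟩ eq ∎)
  ... | U   | Nu  = route (ep ⟨ by U≁Far ⟩ er ⟨ by˘ V≁Far ⟩ cls-v ⟨ by V≁Nu ⟩ eq ∎)
  ... | U   | Nv  = route (ep ⟨ by U≁Nv ⟩ eq ∎)
  ... | U   | Far = route (ep ⟨ by U≁Far ⟩ eq ∎)
  ... | V   | U   = route (ep ⟨ by V≁Far ⟩ er ⟨ by˘ U≁Far ⟩ eq ∎)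
  ... | V   | V   = route (ep ⟨ by V≁V ⟩ eq ∎)
  ... | V   | Nu  = route (ep ⟨ by V≁Nu ⟩ eq ∎)
  ... | V   | Nv  = route (ep ⟨ by V≁Far ⟩ er ⟨ by˘ U≁Far ⟩ cls-u ⟨ by U≁Nv ⟩ eq ∎)
  ... | V   | Far = route (ep ⟨ by V≁Far ⟩ eq ∎)
  ... | Nu  | U   = route (ep ⟨ by˘ V≁Nu ⟩ cls-v ⟨ by V≁Far ⟩ er ⟨ by˘ U≁Far ⟩ eq ∎)
  ... | Nu  | V   = route (ep ⟨ by˘ V≁Nu ⟩ eq ∎)
  ... | Nu  | Nu  = route (ep ⟨ by Nu≁Nu ⟩ eq ∎)
  ... | Nu  | Nv  =
    route (ep ⟨ by˘ V≁Nu ⟩ cls-v ⟨ by V≁Far ⟩ er ⟨ by˘ U≁Far ⟩ cls-u ⟨ by U≁Nv ⟩ eq ∎)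
  ... | Nu  | Far = route (ep ⟨ by˘ V≁Nu ⟩ cls-v ⟨ by V≁Far ⟩ eq ∎)
  ... | Nv  | U   = route (ep ⟨ by˘ U≁Nv ⟩ eq ∎)
  ... | Nv  | V   = route (ep ⟨ by˘ U≁Nv ⟩ cls-u ⟨ by U≁Far ⟩ er ⟨ by˘ V≁Far ⟩ eq ∎)
  ... | Nv  | Nu  =
    route (ep ⟨ by˘ U≁Nv ⟩ cls-u ⟨ by U≁Far ⟩ er ⟨ by˘ V≁Far ⟩ cls-v ⟨ by V≁Nu ⟩ eq ∎)
  ... | Nv  | Nv  = route (ep ⟨ by Nv≁Nv ⟩ eq ∎)
  ... | Nv  | Far = route (ep ⟨ by˘ U≁Nv ⟩ cls-u ⟨ by U≁Far ⟩ eq ∎)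
  ... | Far | U   = route (ep ⟨ by˘ U≁Far ⟩ eq ∎)
  ... | Far | V   = route (ep ⟨ by˘ V≁Far ⟩ eq ∎)
  ... | Far | Nu  = route (ep ⟨ by˘ V≁Far ⟩ cls-v ⟨ by V≁Nu ⟩ eq ∎)
  ... | Far | Nv  = route (ep ⟨ by˘ U≁Far ⟩ cls-u ⟨ by U≁Nv ⟩ eq ∎)
  ... | Far | Far = joined-far-far diam ep eq

  NoFar : Set
  NoFar = ∀ x → cls x ≢ Far

  HubEdge : Set
  HubEdge = ∃[ a ] ∃[ b ] (cls a ≡ Nu × cls b ≡ Nv × Adj H a b)

  joined-via-hub : NoFar → HubEdge → ∀ p q → RainbowJoined H colouring p q
  joined-via-hub no-far (_ , _ , ea , eb , ab) p q with cls p in ep | cls q in eq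
  ... | Far | _   = ⊥-elim (no-far p ep)
  ... | _   | Far = ⊥-elim (no-far q eq)
  ... | U   | U   = route (ep ⟨ by U≁U ⟩ eq ∎)
  ... | U   | V   = route (ep ⟨ by U≁Nv ⟩ eb ⟨ given [ sym H ab ] ⟩ ea ⟨ by˘ V≁Nu ⟩ eq ∎)
  ... | U   | Nu  = route (ep ⟨ by U≁Nv ⟩ eb ⟨ given [ sym H ab ] ⟩ ea ⟨ by Nu≁Nu ⟩ eq ∎)
  ... | U   | Nv  = route (ep ⟨ by U≁Nv ⟩ eq ∎)
  ... | V   | U   = route (ep ⟨ by V≁Nu ⟩ ea ⟨ given [ ab ] ⟩ eb ⟨ by˘ U≁Nv ⟩ eq ∎)
  ... | V   | V   = route (ep ⟨ by V≁V ⟩ eq ∎)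
  ... | V   | Nu  = route (ep ⟨ by V≁Nu ⟩ eq ∎)
  ... | V   | Nv  = route (ep ⟨ by V≁Nu ⟩ ea ⟨ given [ ab ] ⟩ eb ⟨ by Nv≁Nv ⟩ eq ∎)
  ... | Nu  | U   = route (ep ⟨ by Nu≁Nu ⟩ ea ⟨ given [ ab ] ⟩ eb ⟨ by˘ U≁Nv ⟩ eq ∎)
  ... | Nu  | V   = route (ep ⟨ by˘ V≁Nu ⟩ eq ∎)
  ... | Nu  | Nu  = route (ep ⟨ by Nu≁Nu ⟩ eq ∎)
  ... | Nu  | Nv  = route (ep ⟨ by Nu≁Nu ⟩ ea ⟨ given [ ab ] ⟩ eb ⟨ by Nv≁Nv ⟩ eq ∎)
  ... | Nv  | U   = route (ep ⟨ by˘ U≁Nv ⟩ eq ∎)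
  ... | Nv  | V   = route (ep ⟨ by Nv≁Nv ⟩ eb ⟨ given [ sym H ab ] ⟩ ea ⟨ by˘ V≁Nu ⟩ eq ∎)
  ... | Nv  | Nu  = route (ep ⟨ by Nv≁Nv ⟩ eb ⟨ given [ sym H ab ] ⟩ ea ⟨ by Nu≁Nu ⟩ eq ∎)
  ... | Nv  | Nv  = route (ep ⟨ by Nv≁Nv ⟩ eq ∎)

  -- An H-path from u to v has to leave {u} ∪ N(v), and without far vertices it can only
  -- do so by an edge from N(v) to N(u).
  u-side : Class → Bool
  u-side U  = true
  u-side Nv = true
  u-side _  = false

  crossing-is-hub : NoFar → ∀ {x y} → Adj H x y → T (u-side (cls x)) → ¬ T (u-side (cls y)) → HubEdge
  crossing-is-hub no-far {x} {y} xy in-x out-y with cls x in ex | cls y in ey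
  ... | U   | V   with view ex | view ey
  ...   | at-u refl | at-v _ refl = ⊥-elim (proj₂ xy uv)
  crossing-is-hub _ xy _ _ | U  | Nu with view ex | view ey
  ...   | at-u refl | in-Nu _ uy = ⊥-elim (proj₂ xy uy)
  crossing-is-hub _ xy _ _ | Nv | V  with view ex | view ey
  ...   | in-Nv _ _ vx | at-v _ refl = ⊥-elim (proj₂ xy (sym G vx))
  crossing-is-hub _ {x} {y} xy _ _ | Nv | Nu  = y , x , ey , ex , sym H xy
  crossing-is-hub no-far {y = y} _ _ _ | _ | Far = ⊥-elim (no-far y ey)
  crossing-is-hub _ _ _ out-y | _ | U  = ⊥-elim (out-y tt)
  crossing-is-hub _ _ _ out-y | _ | Nv = ⊥-elim (out-y tt)
  crossing-is-hub _ _ () _ | V   | _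
  crossing-is-hub _ _ () _ | Nu  | _
  crossing-is-hub _ _ () _ | Far | _

  hub-edge : NoFar → Connected H → HubEdge
  hub-edge no-far conn with conn u v
  ... | _ , walk , _ , from-u , to-v
    with exit-edge (λ x → T? (u-side (cls x))) walk from-u to-v
                   (subst (T ∘ u-side) (≡sym cls-u) tt) (subst (T ∘ u-side) cls-v)
  ... | x , y , xy , in-x , out-y = crossing-is-hub no-far xy in-x out-y

  complement-rc≤5 : (∀ p q → Dist≤2 G p q) → Connected H → rc≤ H 5
  complement-rc≤5 diam conn = colouring , (λ x y → colourTable-sym (cls x) (cls y)) , joined
    where
    joined : RainbowConnectedBy H colouring
    joined with any? (λ x → cls x ≟ Far)
    ... | yes (_ , er) = joined-via-far er diam
    ... | no ∄far = joined-via-hub no-far (hub-edge no-far conn)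
      where
      no-far : NoFar
      no-far x ex = ∄far (x , ex)

proposition4p3 : (n : ℕ) (G : Graph n) → TriangleFree G → Diam≡2 G →
                 Connected (complement G) → rc≤ (complement G) 5
proposition4p3 n G triangle-free (diam≤2 , u , _ , _ , _ , w , uw , _) =
  EdgePartition.complement-rc≤5 G triangle-free u w uw diam≤2
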